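{- For every finite graph $H$ (simple, possibly a formal sum of graphs on the same number $t$ of vertices) and every finite nonempty graph $G$ (possibly with loops), $$ i(H) \;\leq\; R(H,G) \;\leq\; I(H).$$
   Context: For simple graphs $H$ (on $t$ vertices) and $G$ with $|G|\ge t$, $P(H,G)$ is the number of $t$-element vertex subsets of $G$ inducing a copy of $H$ divided by $\binom{|G|}{t}$. The inducibility is $I(H)=\lim_{n\to\infty}\max_{|G|=n}P(H,G)$ and the minimal inducibility is $i(H)=\lim_{n\to\infty}\min_{|G|=n}P(H,G)$, maxima/minima over simple $n$-vertex graphs. For a graph $G$ which may have loops, $R(H,G)$ is defined as follows: sample vertices $v_1,\dots,v_t$ of $G$ independently and uniformly at random (with replacement) and form the graph on $\{1,\dots,t\}$ in which $i\sim j$ ($i\neq j$) iff $v_i\sim v_j$ in $G$, where for $v_i=v_j$ this means $v_i$ carries a loop; $R(H,G)$ is the probability that this graph is isomorphic to $H$. For formal sums, $P(H+H',G)=P(H,G)+P(H',G)$ and $R(H+H',G)=R(H,G)+R(H',G)$, with $I$ and $i$ defined accordingly. -}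

module Defs where

open import Data.Bool using (Bool; true; false; _∧_; _∨_; not; if_then_else_)
open import Data.Nat using (ℕ; zero; suc; _^_; _<ᵇ_; _≡ᵇ_)
open import Data.Nat.Combinatorics using (_C_)
open import Data.Fin using (Fin; toℕ)
open import Data.List using (List; []; _∷_; map; concatMap; allFin; filterᵇ; length; foldr)
open import Data.Bool.ListAction using (all; any)
open import Data.Integer using (+_)
open import Data.Rational using (ℚ; 0ℚ; _/_; _+_)
open import Relation.Binary.PropositionalEquality using (_≡_)

record SimpleGraph (n : ℕ) : Set where
  field
    adj    : Fin n → Fin n → Bool
    sym    : ∀ i j → adj i j ≡ adj j i
    irrefl : ∀ i → adj i i ≡ false
open SimpleGraph public

record LoopGraph (n : ℕ) : Set where
  field
    ladj : Fin n → Fin n → Bool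
    lsym : ∀ i j → ladj i j ≡ ladj j i
open LoopGraph public

eqB : Bool → Bool → Bool
eqB a b = if a then b else not b

allB : (n : ℕ) → (Fin n → Bool) → Bool
allB n p = all p (allFin n)

sameFin : ∀ {n} → Fin n → Fin n → Bool
sameFin i j = toℕ i ≡ᵇ toℕ j

tuples : (t n : ℕ) → List (Fin t → Fin n)
tuples zero    n = (λ ()) ∷ []
tuples (suc t) n = concatMap (λ x → map (λ f → cons x f) (tuples t n)) (allFin n)
  where
  cons : Fin n → (Fin t → Fin n) → Fin (suc t) → Fin n
  cons x f Fin.zero    = x
  cons x f (Fin.suc i) = f i

injB : ∀ {t n} → (Fin t → Fin n) → Bool
injB {t} f = allB t λ i → allB t λ j → sameFin i j ∨ not (sameFin (f i) (f j))

-- strictly increasing maps Fin t → Fin n correspond exactly to t-element subsets of Fin n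
incrB : ∀ {t n} → (Fin t → Fin n) → Bool
incrB {t} f = allB t λ i → allB t λ j → not (toℕ i <ᵇ toℕ j) ∨ (toℕ (f i) <ᵇ toℕ (f j))

isoB : ∀ {t} → SimpleGraph t → (Fin t → Fin t → Bool) → Bool
isoB {t} H A = any (λ σ → injB σ ∧ (allB t λ i → allB t λ j →
                 sameFin i j ∨ eqB (adj H i j) (A (σ i) (σ j)))) (tuples t t)

-- a / d as a rational (only used with d ≠ 0; d = 0 gives 0 as a junk value)
frac : ℕ → ℕ → ℚ
frac a zero    = 0ℚ
frac a (suc d) = (+ a) / suc d

sumℚ : List ℚ → ℚ
sumℚ = foldr _+_ 0ℚ

inducedCount : ∀ {t n} → SimpleGraph t → SimpleGraph n → ℕ
inducedCount {t} {n} H G =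
  length (filterᵇ (λ f → incrB f ∧ isoB H (λ i j → adj G (f i) (f j))) (tuples t n))

P₁ : ∀ {t n} → SimpleGraph t → SimpleGraph n → ℚ
P₁ {t} {n} H G = frac (inducedCount H G) (n C t)

sampleCount : ∀ {t n} → SimpleGraph t → LoopGraph n → ℕ
sampleCount {t} {n} H G =
  length (filterᵇ (λ v → isoB H (λ i j → ladj G (v i) (v j))) (tuples t n))

R₁ : ∀ {t n} → SimpleGraph t → LoopGraph n → ℚ
R₁ {t} {n} H G = frac (sampleCount H G) (n ^ t)

-- Formal sums H = H₁ + … + H_k of graphs on t vertices are lists; P and R extend additively.
P : ∀ {t n} → List (SimpleGraph t) → SimpleGraph n → ℚ
P H G = sumℚ (map (λ H₁ → P₁ H₁ G) H)

R : ∀ {t n} → List (SimpleGraph t) → LoopGraph n → ℚ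
R H G = sumℚ (map (λ H₁ → R₁ H₁ G) H)

-- Blow the k-vertex graph G up to n vertices: vertex x gets class x mod k, and distinct
-- vertices are adjacent iff their classes are adjacent in G (so a loop turns a class into a
-- clique). Writing q = ⌊n/k⌋, the vertex k·a + c is the a-th member of class c. An increasing
-- t-tuple of rows a together with an arbitrary t-tuple of classes c gives an increasing t-tuple
-- of vertices whose induced graph is exactly the graph sampled from G at the classes c. Hence,
-- with D = C(n,t), K = k^t and c = C(q,t), at least c·s of the D t-subsets induce H, where s
-- counts the t-tuples of G sampling H, and likewise for the complementary event. As t!·D and
-- t!·c·K are products of t factors that differ by at most k·t each, D − c·K = O(D/n), so the
-- induced density P(H, blow-up) is within O(1/n) of R(H,G). The blow-ups therefore witness both
-- i(H) ≤ R(H,G) and R(H,G) ≤ I(H).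
module Submission where

open import Defs hiding (sym)
open import Data.Bool using (Bool; true; false; T; _∧_; _∨_; not; if_then_else_)
open import Data.Bool.ListAction using (and; or)
open import Data.Bool.Properties using (T-∧; T-≡; ∧-identityʳ)
open import Data.Empty using (⊥-elim)
open import Data.Fin as Fin using (Fin; toℕ; combine; inject≤)
import Data.Fin.Properties as Fin
import Data.Integer as ℤ
import Data.Integer.Properties as ℤ
open import Data.List using (List; []; _∷_; _++_; map; concatMap; length; filterᵇ; tabulate; allFin)
open import Data.List.Properties using (filter-++; length-++; map-cong)
open import Data.List.Relation.Unary.All.Properties using (all⁺; all⁻; tabulate⁺; tabulate⁻)
open import Data.Nat
open import Data.Nat.Properties
open import Algebra.Properties.Semiring.Sum +-*-semiring
  using (sum-syntax; sum-cong-≗; *-distribˡ-sum; *-distribʳ-sum)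
open import Data.Nat.Combinatorics using (_C_; _P_; nCk+nC[k+1]≡[n+1]C[k+1]; nCk≡nPk/k!)
open import Data.Nat.Combinatorics.Base using (_P′_)
open import Data.Nat.Combinatorics.Specification using (k!∣nP′k; k>n⇒nCk≡0)
open import Data.Nat.DivMod
  using (_/_; _%_; _mod_; m*[n/m]≡n; m≡m%n+[m/n]*n; m%n<n; m/n*n≤m; [m+kn]%n≡m%n; m<n⇒m%n≡m)
open import Data.Nat.ListAction using (sum)
open import Data.Nat.Solver using (module +-*-Solver)
open +-*-Solver using (solve; _:+_; _:*_; _:=_; con)
open import Data.Product using (Σ; ∃-syntax; _×_; _,_; proj₁; proj₂)
open import Data.Rational using (ℚ; 0ℚ; mkℚ)
import Data.Rational as ℚ
import Data.Rational.Properties as ℚ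
import Data.Rational.Unnormalised as ℚᵘ
import Data.Rational.Unnormalised.Properties as ℚᵘ
open import Data.Unit using (tt)
open import Data.Vec.Functional using (Vector) renaming ([] to []ᵥ; _∷_ to _∷ᵥ_)
open import Function using (_∘_; id)
open import Function.Bundles using (Equivalence)
open import Relation.Binary.Core using (_Preserves_⟶_)
open import Relation.Binary.Definitions using (tri<; tri≈; tri>)
open import Relation.Binary.PropositionalEquality
open import Relation.Nullary.Decidable using (T?; yes; no)

T-injective : ∀ {a b} → (T a → T b) → (T b → T a) → a ≡ b
T-injective {false} {false} _   _   = refl
T-injective {false} {true}  _   b⇒a = ⊥-elim (b⇒a tt)
T-injective {true}  {false} a⇒b _   = ⊥-elim (a⇒b tt)
T-injective {true}  {true}  _   _   = refl

T-not-∨ : ∀ {a b} → T (not a ∨ b) → T a → T b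
T-not-∨ {true} h _ = h

not-∨-T : ∀ {a b} → (T a → T b) → T (not a ∨ b)
not-∨-T {false} _   = tt
not-∨-T {true}  a⇒b = a⇒b tt

allB-cong : ∀ {n} {p q : Fin n → Bool} → p ≗ q → allB n p ≡ allB n q
allB-cong {n} p≗q = cong and (map-cong p≗q (allFin n))

T-allB : ∀ n {p : Fin n → Bool} → T (allB n p) → ∀ i → T (p i)
T-allB n {p} h = tabulate⁻ (all⁺ p (allFin n) h)

allB-T : ∀ n {p : Fin n → Bool} → (∀ i → T (p i)) → T (allB n p)
allB-T n {p} h = all⁻ p (tabulate⁺ h)

sameFin⇒≡ : ∀ {n} (i j : Fin n) → T (sameFin i j) → i ≡ j
sameFin⇒≡ i j h = Fin.toℕ-injective (≡ᵇ⇒≡ _ _ h)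

≡⇒sameFin : ∀ {n} {i j : Fin n} → i ≡ j → T (sameFin i j)
≡⇒sameFin {i = i} refl = ≡⇒≡ᵇ (toℕ i) (toℕ i) refl

sameFin-sym : ∀ {n} (i j : Fin n) → sameFin i j ≡ sameFin j i
sameFin-sym i j = T-injective (≡⇒sameFin ∘ sym ∘ sameFin⇒≡ i j) (≡⇒sameFin ∘ sym ∘ sameFin⇒≡ j i)

sameFin-refl : ∀ {n} (i : Fin n) → sameFin i i ≡ true
sameFin-refl i = Equivalence.to T-≡ (≡⇒sameFin {i = i} refl)

sameFin-≢ : ∀ {n} {i j : Fin n} → i ≢ j → sameFin i j ≡ false
sameFin-≢ {i = i} {j} i≢j = T-injective (⊥-elim ∘ i≢j ∘ sameFin⇒≡ i j) (λ ())

injB-injective : ∀ {t} {σ : Fin t → Fin t} → T (injB σ) → ∀ {i j} → i ≢ j → σ i ≢ σ j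
injB-injective {t} {σ} σ-inj {i} {j} i≢j σi≡σj =
  subst T (cong₂ (λ x y → x ∨ not y) (sameFin-≢ i≢j) (Equivalence.to T-≡ (≡⇒sameFin σi≡σj)))
    (T-allB t (T-allB t σ-inj i) j)

-- isoB only looks at A off the diagonal, since it only tries injective σ.
isoB-cong : ∀ {t} (H : SimpleGraph t) {A B : Fin t → Fin t → Bool} →
  (∀ {i j} → i ≢ j → A i j ≡ B i j) → isoB H A ≡ isoB H B
isoB-cong {t} H {A} {B} A≐B = cong or (map-cong witnesses (tuples t t))
  where
  matches : (Fin t → Fin t → Bool) → (Fin t → Fin t) → Fin t → Fin t → Bool
  matches C σ i j = sameFin i j ∨ eqB (adj H i j) (C (σ i) (σ j))
  witnesses : ∀ σ → (injB σ ∧ allB t λ i → allB t (matches A σ i))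
                  ≡ (injB σ ∧ allB t λ i → allB t (matches B σ i))
  witnesses σ with injB σ in σ-inj
  ... | false = refl
  ... | true  = allB-cong λ i → allB-cong λ j → off-diagonal i j
    where
    off-diagonal : ∀ i j → matches A σ i j ≡ matches B σ i j
    off-diagonal i j with sameFin i j in i≈j
    ... | true  = refl
    ... | false = cong (eqB (adj H i j)) (A≐B (injB-injective {σ = σ} (subst T (sym σ-inj) tt)
                    λ i≡j → subst T i≈j (≡⇒sameFin {i = i} {j} i≡j)))

-- Counting tuples

indicator : Bool → ℕ
indicator b = if b then 1 else 0

count : {A : Set} → (A → Bool) → List A → ℕ
count p xs = length (filterᵇ p xs)

module _ {A : Set} where

  count-++ : ∀ (p : A → Bool) xs ys → count p (xs ++ ys) ≡ count p xs + count p ys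
  count-++ p xs ys = trans (cong length (filter-++ (T? ∘ p) xs ys)) (length-++ (filterᵇ p xs))

  count-cong : ∀ {p q : A → Bool} → p ≗ q → ∀ xs → count p xs ≡ count q xs
  count-cong p≗q []       = refl
  count-cong {p} {q} p≗q (x ∷ xs) with p x | q x | p≗q x
  ... | true  | true  | _ = cong suc (count-cong p≗q xs)
  ... | false | false | _ = count-cong p≗q xs

  count-split : ∀ (p q : A → Bool) xs →
    count p xs ≡ count (λ x → p x ∧ q x) xs + count (λ x → p x ∧ not (q x)) xs
  count-split p q []       = refl
  count-split p q (x ∷ xs) with p x | q x
  ... | false | _     = count-split p q xs
  ... | true  | true  = cong suc (count-split p q xs)
  ... | true  | false = trans (cong suc (count-split p q xs)) (sym (+-suc _ _))

  count-false : ∀ (xs : List A) → count (λ _ → false) xs ≡ 0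
  count-false []       = refl
  count-false (x ∷ xs) = count-false xs

  count-if-∧ : ∀ c (p : A → Bool) xs → count (λ x → c ∧ p x) xs ≡ (if c then count p xs else 0)
  count-if-∧ true  p xs = refl
  count-if-∧ false p xs = count-false xs

  count-singleton : ∀ (p : A → Bool) x → count p (x ∷ []) ≡ indicator (p x)
  count-singleton p x with p x
  ... | true  = refl
  ... | false = refl

count-map : ∀ {A B : Set} (p : B → Bool) (g : A → B) xs → count p (map g xs) ≡ count (p ∘ g) xs
count-map p g []       = refl
count-map p g (x ∷ xs) with p (g x)
... | true  = cong suc (count-map p g xs)
... | false = count-map p g xs

count-concatMap-tabulate : ∀ {A B : Set} (p : A → Bool) n (f : Fin n → B) (h : B → List A) →
  count p (concatMap h (tabulate f)) ≡ ∑[ x < n ] count p (h (f x))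
count-concatMap-tabulate p zero    f h = refl
count-concatMap-tabulate p (suc n) f h = trans (count-++ p (h (f Fin.zero)) _)
  (cong (count p (h (f Fin.zero)) +_) (count-concatMap-tabulate p n (f ∘ Fin.suc) h))

indicator-∧-≤ : ∀ {a b c} → (T a → T b → T c) → indicator a * indicator b ≤ indicator c
indicator-∧-≤ {false}                 _    = z≤n
indicator-∧-≤ {true}  {false}         _    = z≤n
indicator-∧-≤ {true}  {true}  {true}  _    = ≤-refl
indicator-∧-≤ {true}  {true}  {false} ab⇒c = ⊥-elim (ab⇒c tt tt)

∑-mono-≤ : ∀ {n} {f g : Fin n → ℕ} → (∀ i → f i ≤ g i) → ∑[ i < n ] f i ≤ ∑[ i < n ] g i
∑-mono-≤ {zero}  f≤g = z≤n
∑-mono-≤ {suc n} f≤g = +-mono-≤ (f≤g Fin.zero) (∑-mono-≤ (f≤g ∘ Fin.suc))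

∑-const : ∀ n c → ∑[ i < n ] c ≡ n * c
∑-const zero    c = refl
∑-const (suc n) c = cong (c +_) (∑-const n c)

∑-*-∑ : ∀ {a b} (f : Fin a → ℕ) (g : Fin b → ℕ) →
  (∑[ x < a ] f x) * (∑[ y < b ] g y) ≡ ∑[ x < a ] ∑[ y < b ] (f x * g y)
∑-*-∑ f g = trans (*-distribʳ-sum _ f) (sum-cong-≗ (λ x → *-distribˡ-sum (f x) g))

∑-↑ : ∀ a b (g : Fin (a + b) → ℕ) →
  ∑[ i < a + b ] g i ≡ ∑[ i < a ] g (i Fin.↑ˡ b) + ∑[ j < b ] g (a Fin.↑ʳ j)
∑-↑ zero    b g = refl
∑-↑ (suc a) b g = trans (cong (g Fin.zero +_) (∑-↑ a b (g ∘ Fin.suc))) (sym (+-assoc (g Fin.zero) _ _))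

∑-combine : ∀ a b (g : Fin (a * b) → ℕ) → ∑[ i < a * b ] g i ≡ ∑[ i < a ] ∑[ j < b ] g (combine i j)
∑-combine zero    b g = refl
∑-combine (suc a) b g = trans (∑-↑ b (a * b) g)
  (cong (∑[ j < b ] g (j Fin.↑ˡ (a * b)) +_) (∑-combine a b (g ∘ (b Fin.↑ʳ_))))

∑-inject≤ : ∀ {a b} (a≤b : a ≤ b) (g : Fin b → ℕ) → ∑[ i < a ] g (inject≤ i a≤b) ≤ ∑[ i < b ] g i
∑-inject≤ {zero}          a≤b g = z≤n
∑-inject≤ {suc a} {suc b} a≤b g = +-monoʳ-≤ (g Fin.zero) (∑-inject≤ (s≤s⁻¹ a≤b) (g ∘ Fin.suc))

-- tuples builds its lists with a private cons, which agrees with _∷ᵥ_ only pointwise; the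
-- counting lemmas therefore need predicates that respect pointwise equality.
Extensional : ∀ {t n} → (Vector (Fin n) t → Bool) → Set
Extensional F = F Preserves _≗_ ⟶ _≡_

∷-cong : ∀ {t n} (x : Fin n) {u v : Vector (Fin n) t} → u ≗ v → (x ∷ᵥ u) ≗ (x ∷ᵥ v)
∷-cong x u≗v Fin.zero    = refl
∷-cong x u≗v (Fin.suc i) = u≗v i

extensional-∷ : ∀ {t n} {F : Vector (Fin n) (suc t) → Bool} → Extensional F →
  ∀ x → Extensional (λ w → F (x ∷ᵥ w))
extensional-∷ F-ext x u≗v = F-ext (∷-cong x u≗v)

count-tuples-zero : ∀ {n} {F : Vector (Fin n) 0 → Bool} → Extensional F →
  count F (tuples 0 n) ≡ indicator (F []ᵥ)
count-tuples-zero {F = F} F-ext = trans (count-singleton F _) (cong indicator (F-ext (λ ())))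

count-tuples-suc : ∀ {t n} {F : Vector (Fin n) (suc t) → Bool} → Extensional F →
  count F (tuples (suc t) n) ≡ ∑[ x < n ] count (λ w → F (x ∷ᵥ w)) (tuples t n)
count-tuples-suc {t} {n} {F} F-ext = trans (count-concatMap-tabulate F n id _) (sum-cong-≗ λ x →
  trans (count-map F _ (tuples t n))
        (count-cong {q = λ w → F (x ∷ᵥ w)} (λ w → F-ext λ { Fin.zero → refl ; (Fin.suc i) → refl }) (tuples t n)))

count-tuples-true : ∀ t n → count (λ _ → true) (tuples t n) ≡ n ^ t
count-tuples-true zero    n = refl
count-tuples-true (suc t) n = begin
  count (λ _ → true) (tuples (suc t) n)       ≡⟨ count-tuples-suc {t} {n} (λ _ → refl) ⟩
  ∑[ x < n ] count (λ _ → true) (tuples t n)  ≡⟨ sum-cong-≗ {n = n} (λ _ → count-tuples-true t n) ⟩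
  ∑[ x < n ] (n ^ t)                          ≡⟨ ∑-const n (n ^ t) ⟩
  n * n ^ t                                   ∎
  where open ≡-Reasoning

-- ∑-φ is the injectivity of φ, in the form the induction on t consumes.
module _ {a b n : ℕ} (φ : Fin a → Fin b → Fin n)
         (∑-φ : ∀ (g : Fin n → ℕ) → ∑[ x < a ] ∑[ y < b ] g (φ x y) ≤ ∑[ z < n ] g z) where

  count-tuples-pairing : ∀ t {A : Vector (Fin a) t → Bool} {B : Vector (Fin b) t → Bool}
    {F : Vector (Fin n) t → Bool} → Extensional A → Extensional B → Extensional F →
    (∀ u v → T (A u) → T (B v) → T (F (λ i → φ (u i) (v i)))) →
    count A (tuples t a) * count B (tuples t b) ≤ count F (tuples t n)
  count-tuples-pairing zero {A} {B} {F} A-ext B-ext F-ext AB⇒F = begin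
    count A (tuples 0 a) * count B (tuples 0 b)  ≡⟨ cong₂ _*_ (count-tuples-zero A-ext) (count-tuples-zero B-ext) ⟩
    indicator (A []ᵥ) * indicator (B []ᵥ)
      ≤⟨ indicator-∧-≤ (λ Au Bv → subst T (F-ext (λ ())) (AB⇒F []ᵥ []ᵥ Au Bv)) ⟩
    indicator (F []ᵥ)                            ≡⟨ count-tuples-zero F-ext ⟨
    count F (tuples 0 n)                         ∎
    where open ≤-Reasoning
  count-tuples-pairing (suc t) {A} {B} {F} A-ext B-ext F-ext AB⇒F = begin
    count A (tuples (suc t) a) * count B (tuples (suc t) b)
      ≡⟨ cong₂ _*_ (count-tuples-suc A-ext) (count-tuples-suc B-ext) ⟩
    (∑[ x < a ] countA x) * (∑[ y < b ] countB y)
      ≡⟨ ∑-*-∑ countA countB ⟩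
    ∑[ x < a ] ∑[ y < b ] (countA x * countB y)
      ≤⟨ ∑-mono-≤ (λ x → ∑-mono-≤ (λ y → count-tuples-pairing t
           (extensional-∷ A-ext x) (extensional-∷ B-ext y) (extensional-∷ F-ext (φ x y))
           (λ u v Au Bv → subst T (F-ext (φ-∷ x y u v)) (AB⇒F (x ∷ᵥ u) (y ∷ᵥ v) Au Bv)))) ⟩
    ∑[ x < a ] ∑[ y < b ] countF (φ x y)
      ≤⟨ ∑-φ countF ⟩
    ∑[ z < n ] countF z
      ≡⟨ count-tuples-suc F-ext ⟨
    count F (tuples (suc t) n) ∎
    where
    open ≤-Reasoning
    countA : Fin a → ℕ
    countA x = count (λ w → A (x ∷ᵥ w)) (tuples t a)
    countB : Fin b → ℕ
    countB y = count (λ w → B (y ∷ᵥ w)) (tuples t b)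
    countF : Fin n → ℕ
    countF z = count (λ w → F (z ∷ᵥ w)) (tuples t n)
    φ-∷ : ∀ x y u v → (λ i → φ ((x ∷ᵥ u) i) ((y ∷ᵥ v) i)) ≗ (φ x y ∷ᵥ λ i → φ (u i) (v i))
    φ-∷ x y u v Fin.zero    = refl
    φ-∷ x y u v (Fin.suc i) = refl

-- Increasing tuples

Increasing : ∀ {t n} → Vector (Fin n) t → Set
Increasing {t} f = ∀ {i j : Fin t} → i Fin.< j → f i Fin.< f j

incrB-increasing : ∀ {t n} {f : Vector (Fin n) t} → T (incrB f) → Increasing f
incrB-increasing {t} h {i} {j} i<j = <ᵇ⇒< _ _ (T-not-∨ (T-allB t (T-allB t h i) j) (<⇒<ᵇ i<j))

increasing-incrB : ∀ {t n} {f : Vector (Fin n) t} → Increasing f → T (incrB f)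
increasing-incrB {t} f↑ = allB-T t λ i → allB-T t λ j → not-∨-T λ i<j → <⇒<ᵇ (f↑ (<ᵇ⇒< _ _ i<j))

incrB-extensional : ∀ {t n} → Extensional (incrB {t} {n})
incrB-extensional f≗g = allB-cong λ i → allB-cong λ j →
  cong₂ (λ x y → not (toℕ i <ᵇ toℕ j) ∨ (toℕ x <ᵇ toℕ y)) (f≗g i) (f≗g j)

increasing-injective : ∀ {t n} {f : Vector (Fin n) t} → Increasing f → ∀ {i j} → i ≢ j → f i ≢ f j
increasing-injective f↑ {i} {j} i≢j with Fin.<-cmp i j
... | tri< i<j _ _ = Fin.<⇒≢ (f↑ i<j)
... | tri≈ _ i≡j _ = ⊥-elim (i≢j i≡j)
... | tri> _ _ j<i = Fin.<⇒≢ (f↑ j<i) ∘ sym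

-- The lower bound b makes the family closed under dropping the first entry.
increasingAbove : ∀ {t n} → ℕ → Vector (Fin n) t → Bool
increasingAbove {t} b f = incrB f ∧ allB t (λ j → b ≤ᵇ toℕ (f j))

increasingAbove-extensional : ∀ {t n} b → Extensional (increasingAbove {t} {n} b)
increasingAbove-extensional b f≗g =
  cong₂ _∧_ (incrB-extensional f≗g) (allB-cong λ j → cong (λ x → b ≤ᵇ toℕ x) (f≗g j))

increasingAbove-∷ : ∀ {t n} b (x : Fin n) (w : Vector (Fin n) t) →
  increasingAbove b (x ∷ᵥ w) ≡ (b ≤ᵇ toℕ x) ∧ increasingAbove (suc (toℕ x)) w
increasingAbove-∷ {t} b x w = T-injective split join
  where
  split : T (increasingAbove b (x ∷ᵥ w)) → T ((b ≤ᵇ toℕ x) ∧ increasingAbove (suc (toℕ x)) w)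
  split h with Equivalence.to (T-∧ {incrB (x ∷ᵥ w)}) h
  ... | x∷w-incr , x∷w-above = Equivalence.from (T-∧ {b ≤ᵇ toℕ x}) (T-allB (suc t) x∷w-above Fin.zero ,
        Equivalence.from (T-∧ {incrB w}) (increasing-incrB {f = w} (x∷w↑ ∘ s<s) ,
                              allB-T t (λ j → ≤⇒≤ᵇ (x∷w↑ {Fin.zero} {Fin.suc j} z<s))))
    where
    x∷w↑ : Increasing (x ∷ᵥ w)
    x∷w↑ = incrB-increasing {f = x ∷ᵥ w} x∷w-incr
  join : T ((b ≤ᵇ toℕ x) ∧ increasingAbove (suc (toℕ x)) w) → T (increasingAbove b (x ∷ᵥ w))
  join h with Equivalence.to (T-∧ {b ≤ᵇ toℕ x}) h
  ... | b≤x , rest with Equivalence.to (T-∧ {incrB w}) rest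
  ... | w-incr , w-above =
    Equivalence.from (T-∧ {incrB (x ∷ᵥ w)}) (increasing-incrB {f = x ∷ᵥ w} x∷w↑ , allB-T (suc t) x∷w-above)
    where
    x<w : ∀ j → x Fin.< w j
    x<w j = ≤ᵇ⇒≤ _ _ (T-allB t w-above j)
    x∷w↑ : Increasing (x ∷ᵥ w)
    x∷w↑ {Fin.zero}  {Fin.suc j} _   = x<w j
    x∷w↑ {Fin.suc i} {Fin.suc j} i<j = incrB-increasing {f = w} w-incr (s<s⁻¹ i<j)
    x∷w-above : ∀ j → T (b ≤ᵇ toℕ ((x ∷ᵥ w) j))
    x∷w-above Fin.zero    = b≤x
    x∷w-above (Fin.suc j) = ≤⇒≤ᵇ {b} (≤-trans (≤ᵇ⇒≤ _ _ b≤x) (<⇒≤ (x<w j)))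

suc≤ᵇsuc : ∀ b y → (suc b ≤ᵇ suc y) ≡ (b ≤ᵇ y)
suc≤ᵇsuc zero    y = refl
suc≤ᵇsuc (suc b) y = refl

∑-hockey-stick : ∀ t n b →
  ∑[ x < n ] (if b ≤ᵇ toℕ x then (n ∸ suc (toℕ x)) C t else 0) ≡ (n ∸ b) C suc t
∑-hockey-stick t zero    b       = cong (_C suc t) (sym (0∸n≡0 b))
∑-hockey-stick t (suc n) zero    =
  trans (cong (n C t +_) (∑-hockey-stick t n zero)) (nCk+nC[k+1]≡[n+1]C[k+1] n t)
∑-hockey-stick t (suc n) (suc b) = trans (sum-cong-≗ {n = n} λ x →
  cong (λ c → if c then (n ∸ suc (toℕ x)) C t else 0) (suc≤ᵇsuc b (toℕ x))) (∑-hockey-stick t n b)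

count-increasingAbove : ∀ t n b → count (increasingAbove b) (tuples t n) ≡ (n ∸ b) C t
count-increasingAbove zero    n b = refl
count-increasingAbove (suc t) n b = begin
  count (increasingAbove b) (tuples (suc t) n)
    ≡⟨ count-tuples-suc {t} {n} (increasingAbove-extensional b) ⟩
  ∑[ x < n ] count (λ w → increasingAbove b (x ∷ᵥ w)) (tuples t n)
    ≡⟨ sum-cong-≗ {n = n} (λ x → trans (count-cong (increasingAbove-∷ b x) (tuples t n))
                                       (count-if-∧ (b ≤ᵇ toℕ x) _ (tuples t n))) ⟩
  ∑[ x < n ] (if b ≤ᵇ toℕ x then count (increasingAbove (suc (toℕ x))) (tuples t n) else 0)
    ≡⟨ sum-cong-≗ {n = n} (λ x → cong (if b ≤ᵇ toℕ x then_else 0) (count-increasingAbove t n (suc (toℕ x)))) ⟩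
  ∑[ x < n ] (if b ≤ᵇ toℕ x then (n ∸ suc (toℕ x)) C t else 0)
    ≡⟨ ∑-hockey-stick t n b ⟩
  (n ∸ b) C suc t ∎
  where open ≡-Reasoning

count-increasing : ∀ t n → count incrB (tuples t n) ≡ n C t
count-increasing t n =
  trans (count-cong (λ f → sym (trans (cong (incrB f ∧_) allB-true) (∧-identityʳ (incrB f)))) (tuples t n))
        (count-increasingAbove t n 0)
  where
  allB-true : allB t (λ _ → true) ≡ true
  allB-true = T-injective (λ _ → tt) (λ _ → allB-T t (λ _ → tt))

-- Binomial coefficients

∏ : ℕ → (ℕ → ℕ) → ℕ
∏ zero    f = 1
∏ (suc t) f = f t * ∏ t f

syntax ∏ t (λ i → x) = ∏[ i < t ] x

P′≡∏ : ∀ n t → n P′ t ≡ ∏[ i < t ] (n ∸ i)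
P′≡∏ n zero    = refl
P′≡∏ n (suc t) = cong ((n ∸ t) *_) (P′≡∏ n t)

P′-vanishes : ∀ {n k} → n < k → n P′ k ≡ 0
P′-vanishes {n} {suc k} (s≤s n≤k) = cong (_* (n P′ k)) (m≤n⇒m∸n≡0 n≤k)

k!*nCk≡nP′k : ∀ n k → k ! * (n C k) ≡ n P′ k
k!*nCk≡nP′k n k with k ≤? n
... | no  k≰n = begin
  k ! * (n C k) ≡⟨ cong (k ! *_) (k>n⇒nCk≡0 (≰⇒> k≰n)) ⟩
  k ! * 0       ≡⟨ *-zeroʳ (k !) ⟩
  0             ≡⟨ P′-vanishes (≰⇒> k≰n) ⟨
  n P′ k        ∎
  where open ≡-Reasoning
... | yes k≤n = begin
  k ! * (n C k)          ≡⟨ cong (k ! *_) (nCk≡nPk/k! k≤n) ⟩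
  k ! * (_P_ n k / k !)  ≡⟨ cong (λ x → k ! * (x / k !)) nPk≡nP′k ⟩
  k ! * ((n P′ k) / k !) ≡⟨ m*[n/m]≡n (k!∣nP′k k≤n) ⟩
  n P′ k                 ∎
  where
  open ≡-Reasoning
  instance
    k!≢0 : NonZero (k !)
    k!≢0 = k !≢0
  nPk≡nP′k : _P_ n k ≡ n P′ k
  nPk≡nP′k = cong (if_then n P′ k else 0) (Equivalence.to T-≡ (≤⇒≤ᵇ k≤n))

k≤n⇒nCk>0 : ∀ {n k} → k ≤ n → 0 < n C k
k≤n⇒nCk>0 {n}     {zero}  _         = z<s
k≤n⇒nCk>0 {suc n} {suc k} (s≤s k≤n) =
  <-≤-trans (k≤n⇒nCk>0 k≤n) (≤-trans (m≤m+n _ _) (≤-reflexive (nCk+nC[k+1]≡[n+1]C[k+1] n k)))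

^-*-∏ : ∀ k t (f : ℕ → ℕ) → k ^ t * ∏[ i < t ] f i ≡ ∏[ i < t ] (k * f i)
^-*-∏ k zero    f = refl
^-*-∏ k (suc t) f = begin
  (k * k ^ t) * (f t * ∏ t f)
    ≡⟨ solve 4 (λ k K x X → (k :* K) :* (x :* X) := (k :* x) :* (K :* X)) refl k (k ^ t) (f t) (∏ t f) ⟩
  (k * f t) * (k ^ t * ∏ t f)
    ≡⟨ cong ((k * f t) *_) (^-*-∏ k t f) ⟩
  (k * f t) * ∏[ i < t ] (k * f i) ∎
  where open ≡-Reasoning

∏-mono-≤ : ∀ t {f g : ℕ → ℕ} → (∀ {i} → i < t → f i ≤ g i) → ∏ t f ≤ ∏ t g
∏-mono-≤ zero    f≤g = ≤-refl
∏-mono-≤ (suc t) f≤g = *-mono-≤ (f≤g (n<1+n t)) (∏-mono-≤ t (f≤g ∘ m<n⇒m<1+n))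

-- Telescoping: ∏ b − ∏ a ≤ ∑ᵢ (bᵢ − aᵢ) ∏_{j ≠ i} bⱼ ≤ t γ ∏ b / β.
∏-gap : ∀ t (a b : ℕ → ℕ) β γ → (∀ {i} → i < t → a i ≤ b i) → (∀ {i} → i < t → β ≤ b i) →
  (∀ {i} → i < t → b i ≤ a i + γ) → ∏ t b * β ≤ ∏ t a * β + t * γ * ∏ t b
∏-gap zero    a b β γ _   _   _     = m≤m+n (1 * β) 0
∏-gap (suc t) a b β γ a≤b β≤b b≤a+γ = begin
  (b t * B) * β                                      ≡⟨ *-assoc (b t) B β ⟩
  b t * (B * β)                                      ≤⟨ *-monoʳ-≤ (b t) (∏-gap t a b β γ
                                                          (a≤b ∘ <-up) (β≤b ∘ <-up) (b≤a+γ ∘ <-up)) ⟩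
  b t * (A * β + t * γ * B)                          ≡⟨ *-distribˡ-+ (b t) (A * β) _ ⟩
  b t * (A * β) + b t * (t * γ * B)                  ≤⟨ +-monoˡ-≤ _ (*-monoˡ-≤ (A * β) (b≤a+γ (n<1+n t))) ⟩
  (a t + γ) * (A * β) + b t * (t * γ * B)            ≡⟨ cong (_+ b t * (t * γ * B)) (*-distribʳ-+ (A * β) (a t) γ) ⟩
  (a t * (A * β) + γ * (A * β)) + b t * (t * γ * B)  ≤⟨ +-monoˡ-≤ _ (+-monoʳ-≤ (a t * (A * β)) (*-monoʳ-≤ γ
                                                          (*-mono-≤ (∏-mono-≤ t (a≤b ∘ <-up)) (β≤b (n<1+n t))))) ⟩
  (a t * (A * β) + γ * (B * b t)) + b t * (t * γ * B)
    ≡⟨ solve 7 (λ a b A B β γ t → (a :* (A :* β) :+ γ :* (B :* b)) :+ b :* (t :* γ :* B)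
                                  := (a :* A) :* β :+ (con 1 :+ t) :* γ :* (b :* B)) refl (a t) (b t) A B β γ t ⟩
  (a t * A) * β + suc t * γ * (b t * B)              ∎
  where
  open ≤-Reasoning
  A B : ℕ
  A = ∏ t a
  B = ∏ t b
  <-up : ∀ {i} → i < t → i < suc t
  <-up = m<n⇒m<1+n

n<k+[n/k]*k : ∀ n k .{{_ : NonZero k}} → n < k + (n / k) * k
n<k+[n/k]*k n k = begin-strict
  n                     ≡⟨ m≡m%n+[m/n]*n n k ⟩
  n % k + (n / k) * k   <⟨ +-monoˡ-< ((n / k) * k) (m%n<n n k) ⟩
  k + (n / k) * k       ∎
  where open ≤-Reasoning

-- t!·C(n,t) = ∏ (n − i) and t!·C(⌊n/k⌋,t)·k^t = ∏ k(⌊n/k⌋ − i), factors within k·t of each other.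
binomial-≤-blocks : ∀ k .{{_ : NonZero k}} n t → t ≤ n →
  (n C t) * suc (n ∸ t) ≤ ((n / k) C t) * k ^ t * suc (n ∸ t) + t * (k * t) * (n C t)
binomial-≤-blocks k n t t≤n = *-cancelˡ-≤ (t !) {{t !≢0}} (begin
  t ! * (D * β)                                      ≡⟨ *-assoc (t !) D β ⟨
  (t ! * D) * β                                      ≡⟨ cong (_* β) (sym ∏b≡) ⟩
  ∏ t b * β                                          ≤⟨ ∏-gap t a b β (k * t) a≤b β≤b b≤a+kt ⟩
  ∏ t a * β + t * (k * t) * ∏ t b                    ≡⟨ cong₂ (λ x y → x * β + t * (k * t) * y) ∏a≡ ∏b≡ ⟩
  (k ^ t * (t ! * c)) * β + t * (k * t) * (t ! * D)
    ≡⟨ solve 6 (λ K f c β T D → (K :* (f :* c)) :* β :+ T :* (f :* D) := f :* (c :* K :* β :+ T :* D))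
               refl (k ^ t) (t !) c β (t * (k * t)) D ⟩
  t ! * (c * k ^ t * β + t * (k * t) * D)            ∎)
  where
  open ≤-Reasoning
  q c D β : ℕ
  q = n / k
  c = q C t
  D = n C t
  β = suc (n ∸ t)
  a b : ℕ → ℕ
  a i = k * (q ∸ i)
  b i = n ∸ i
  ∏a≡ : ∏ t a ≡ k ^ t * (t ! * c)
  ∏a≡ = sym (trans (cong (k ^ t *_) (trans (k!*nCk≡nP′k q t) (P′≡∏ q t))) (^-*-∏ k t (q ∸_)))
  ∏b≡ : ∏ t b ≡ t ! * D
  ∏b≡ = sym (trans (k!*nCk≡nP′k n t) (P′≡∏ n t))
  a≤b : ∀ {i} → i < t → a i ≤ b i
  a≤b {i} _ = begin
    k * (q ∸ i)   ≡⟨ *-distribˡ-∸ k q i ⟩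
    k * q ∸ k * i ≤⟨ ∸-mono (≤-trans (≤-reflexive (*-comm k q)) (m/n*n≤m n k)) (m≤n*m i k) ⟩
    n ∸ i         ∎
  β≤b : ∀ {i} → i < t → β ≤ b i
  β≤b i<t = ∸-monoʳ-< i<t t≤n
  b≤a+kt : ∀ {i} → i < t → b i ≤ a i + k * t
  b≤a+kt {i} i<t = <⇒≤ (begin-strict
    n ∸ i                   ≤⟨ m∸n≤m n i ⟩
    n                       <⟨ n<k+[n/k]*k n k ⟩
    k + q * k               ≡⟨ *-comm (suc q) k ⟩
    k * suc q               ≤⟨ *-monoʳ-≤ k (s≤s (m≤n+m∸n q i)) ⟩
    k * (suc i + (q ∸ i))   ≡⟨ *-distribˡ-+ k (suc i) (q ∸ i) ⟩
    k * suc i + k * (q ∸ i) ≤⟨ +-monoˡ-≤ (k * (q ∸ i)) (*-monoʳ-≤ k i<t) ⟩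
    k * t + k * (q ∸ i)     ≡⟨ +-comm (k * t) (k * (q ∸ i)) ⟩
    k * (q ∸ i) + k * t     ∎)

binomial-blocks-deficit : ∀ k .{{_ : NonZero k}} n t → t ≤ n →
  ((n C t) ∸ ((n / k) C t) * k ^ t) * suc (n ∸ t) ≤ t * (k * t) * (n C t)
binomial-blocks-deficit k n t t≤n = begin
  ((n C t) ∸ ((n / k) C t) * k ^ t) * suc (n ∸ t)
    ≡⟨ *-distribʳ-∸ (suc (n ∸ t)) (n C t) (((n / k) C t) * k ^ t) ⟩
  (n C t) * suc (n ∸ t) ∸ ((n / k) C t) * k ^ t * suc (n ∸ t)
    ≤⟨ m≤n+o⇒m∸n≤o _ _ (binomial-≤-blocks k n t t≤n) ⟩
  t * (k * t) * (n C t) ∎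
  where open ≤-Reasoning

-- Comparing densities

-- X + Y = D with X ≥ c·s and Y ≥ c·s′ forces X ≤ c·s + (D − c·K), so X/D and s/K differ by at
-- most (D − c·K)/D; the two inequalities say this with denominators cleared.
complementary-bounds-close : ∀ {X Y s s′ c K D} → X + Y ≡ D → s + s′ ≡ K → c * s ≤ X → c * s′ ≤ Y →
  (X * K ≤ s * D + (D ∸ c * K) * K) × (s * D ≤ X * K + (D ∸ c * K) * K)
complementary-bounds-close {X} {Y} {s} {s′} {c} {K} {D} X+Y≡D s+s′≡K cs≤X cs′≤Y = X*K≤ , s*D≤
  where
  open ≤-Reasoning
  E : ℕ
  E = D ∸ c * K
  cK≤D : c * K ≤ D
  cK≤D = begin
    c * K          ≡⟨ cong (c *_) s+s′≡K ⟨
    c * (s + s′)   ≡⟨ *-distribˡ-+ c s s′ ⟩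
    c * s + c * s′ ≤⟨ +-mono-≤ cs≤X cs′≤Y ⟩
    X + Y          ≡⟨ X+Y≡D ⟩
    D              ∎
  D≡cK+E : D ≡ c * K + E
  D≡cK+E = sym (m+[n∸m]≡n cK≤D)
  X≤cs+E : X ≤ c * s + E
  X≤cs+E = +-cancelʳ-≤ (c * s′) X (c * s + E) (begin
    X + c * s′         ≤⟨ +-monoʳ-≤ X cs′≤Y ⟩
    X + Y              ≡⟨ trans X+Y≡D D≡cK+E ⟩
    c * K + E          ≡⟨ cong (λ z → c * z + E) s+s′≡K ⟨
    c * (s + s′) + E   ≡⟨ solve 4 (λ c s s′ E → c :* (s :+ s′) :+ E := (c :* s :+ E) :+ c :* s′) refl c s s′ E ⟩
    c * s + E + c * s′ ∎)
  X*K≤ : X * K ≤ s * D + E * K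
  X*K≤ = begin
    X * K               ≤⟨ *-monoˡ-≤ K X≤cs+E ⟩
    (c * s + E) * K     ≡⟨ solve 4 (λ c s E K → (c :* s :+ E) :* K := s :* (c :* K) :+ E :* K) refl c s E K ⟩
    s * (c * K) + E * K ≤⟨ +-monoˡ-≤ (E * K) (*-monoʳ-≤ s cK≤D) ⟩
    s * D + E * K       ∎
  s*D≤ : s * D ≤ X * K + E * K
  s*D≤ = begin
    s * D               ≡⟨ cong (s *_) D≡cK+E ⟩
    s * (c * K + E)     ≡⟨ solve 4 (λ c s E K → s :* (c :* K :+ E) := (c :* s) :* K :+ E :* s) refl c s E K ⟩
    (c * s) * K + E * s ≤⟨ +-mono-≤ (*-monoˡ-≤ K cs≤X)
                                    (*-monoʳ-≤ E (≤-trans (m≤m+n s s′) (≤-reflexive s+s′≡K))) ⟩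
    X * K + E * K       ∎

sum-map-≤ : ∀ {A : Set} (f g : A → ℕ) c → (∀ x → f x ≤ g x + c) →
  ∀ xs → sum (map f xs) ≤ sum (map g xs) + length xs * c
sum-map-≤ f g c f≤g+c []       = z≤n
sum-map-≤ f g c f≤g+c (x ∷ xs) = begin
  f x + sum (map f xs)                         ≤⟨ +-mono-≤ (f≤g+c x) (sum-map-≤ f g c f≤g+c xs) ⟩
  (g x + c) + (sum (map g xs) + length xs * c)
    ≡⟨ solve 4 (λ a c b l → (a :+ c) :+ (b :+ l :* c) := (a :+ b) :+ (con 1 :+ l) :* c)
               refl (g x) c (sum (map g xs)) (length xs) ⟩
  (g x + sum (map g xs)) + suc (length xs) * c ∎
  where open ≤-Reasoning

sum-map-*ʳ : ∀ {A : Set} (f : A → ℕ) c xs → sum (map (λ x → f x * c) xs) ≡ sum (map f xs) * c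
sum-map-*ʳ f c []       = refl
sum-map-*ʳ f c (x ∷ xs) = trans (cong (f x * c +_) (sum-map-*ʳ f c xs)) (sym (*-distribʳ-+ c (f x) _))

-- The blow-up

samples : ∀ {t k} → SimpleGraph t → LoopGraph k → Vector (Fin k) t → Bool
samples H G v = isoB H (λ i j → ladj G (v i) (v j))

induces : ∀ {t n} → SimpleGraph t → SimpleGraph n → Vector (Fin n) t → Bool
induces H G f = isoB H (λ i j → adj G (f i) (f j))

samples-extensional : ∀ {t k} (H : SimpleGraph t) (G : LoopGraph k) → Extensional (samples H G)
samples-extensional H G u≗v = isoB-cong H λ {i} {j} _ → cong₂ (ladj G) (u≗v i) (u≗v j)

induces-extensional : ∀ {t n} (H : SimpleGraph t) (G : SimpleGraph n) → Extensional (induces H G)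
induces-extensional H G u≗v = isoB-cong H λ {i} {j} _ → cong₂ (adj G) (u≗v i) (u≗v j)

blowup : ∀ {k} .{{_ : NonZero k}} → LoopGraph k → (n : ℕ) → SimpleGraph n
blowup {k} G n = record
  { adj    = λ x y → not (sameFin x y) ∧ ladj G (toℕ x mod k) (toℕ y mod k)
  ; sym    = λ x y → cong₂ (λ s e → not s ∧ e) (sameFin-sym x y) (lsym G _ _)
  ; irrefl = λ x → cong (λ s → not s ∧ ladj G (toℕ x mod k) (toℕ x mod k)) (sameFin-refl x)
  }

k*a+c<k*b+d : ∀ k {a b c} d → a < b → c < k → k * a + c < k * b + d
k*a+c<k*b+d k {a} {b} {c} d a<b c<k = begin-strict
  k * a + c   <⟨ +-monoʳ-< (k * a) c<k ⟩
  k * a + k   ≡⟨ +-comm (k * a) k ⟩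
  k + k * a   ≡⟨ *-suc k a ⟨
  k * suc a   ≤⟨ *-monoʳ-≤ k a<b ⟩
  k * b       ≤⟨ m≤m+n (k * b) d ⟩
  k * b + d   ∎
  where open ≤-Reasoning

module Blowup {k} .{{_ : NonZero k}} (G : LoopGraph k) (n : ℕ) where

  q : ℕ
  q = n / k

  ι : Fin q → Fin k → Fin n
  ι a c = inject≤ (combine a c) (m/n*n≤m n k)

  toℕ-ι : ∀ a c → toℕ (ι a c) ≡ k * toℕ a + toℕ c
  toℕ-ι a c = trans (Fin.toℕ-inject≤ (combine a c) _) (Fin.toℕ-combine a c)

  ι-mod : ∀ a c → toℕ (ι a c) mod k ≡ c
  ι-mod a c = Fin.toℕ-injective (begin
    toℕ (toℕ (ι a c) mod k)     ≡⟨ Fin.toℕ-fromℕ< (m%n<n (toℕ (ι a c)) k) ⟩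
    toℕ (ι a c) % k             ≡⟨ cong (_% k) (trans (toℕ-ι a c) (+-comm (k * toℕ a) (toℕ c))) ⟩
    (toℕ c + k * toℕ a) % k     ≡⟨ cong (λ x → (toℕ c + x) % k) (*-comm k (toℕ a)) ⟩
    (toℕ c + toℕ a * k) % k     ≡⟨ [m+kn]%n≡m%n (toℕ c) (toℕ a) k ⟩
    toℕ c % k                   ≡⟨ m<n⇒m%n≡m (Fin.toℕ<n c) ⟩
    toℕ c                       ∎)
    where open ≡-Reasoning

  ∑-ι : ∀ (g : Fin n → ℕ) → ∑[ a < q ] ∑[ c < k ] g (ι a c) ≤ ∑[ x < n ] g x
  ∑-ι g = begin
    ∑[ a < q ] ∑[ c < k ] g (ι a c)            ≡⟨ ∑-combine q k (λ w → g (inject≤ w (m/n*n≤m n k))) ⟨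
    ∑[ w < q * k ] g (inject≤ w (m/n*n≤m n k)) ≤⟨ ∑-inject≤ (m/n*n≤m n k) g ⟩
    ∑[ x < n ] g x                             ∎
    where open ≤-Reasoning

  module _ {t} {u : Vector (Fin q) t} (u↑ : Increasing u) (v : Vector (Fin k) t) where

    ι-increasing : Increasing (λ i → ι (u i) (v i))
    ι-increasing {i} {j} i<j = subst₂ _<_ (sym (toℕ-ι (u i) (v i))) (sym (toℕ-ι (u j) (v j)))
      (k*a+c<k*b+d k (toℕ (v j)) (u↑ i<j) (Fin.toℕ<n (v i)))

    ι-adjacency : ∀ {i j} → i ≢ j → adj (blowup G n) (ι (u i) (v i)) (ι (u j) (v j)) ≡ ladj G (v i) (v j)
    ι-adjacency i≢j = cong₂ (λ s e → not s ∧ e) (sameFin-≢ (increasing-injective ι-increasing i≢j))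
      (cong₂ (ladj G) (ι-mod _ _) (ι-mod _ _))

  count-blowup : ∀ {t} (H : SimpleGraph t) (κ : Bool → Bool) →
    (q C t) * count (κ ∘ samples H G) (tuples t k)
      ≤ count (λ f → incrB f ∧ κ (induces H (blowup G n) f)) (tuples t n)
  count-blowup {t} H κ = ≤-trans (≤-reflexive (cong (_* _) (sym (count-increasing t q))))
    (count-tuples-pairing ι ∑-ι t incrB-extensional (cong κ ∘ samples-extensional H G)
      (λ f≗g → cong₂ _∧_ (incrB-extensional f≗g) (cong κ (induces-extensional H (blowup G n) f≗g)))
      pairing)
    where
    pairing : ∀ u v → T (incrB u) → T (κ (samples H G v)) →
      T (incrB (λ i → ι (u i) (v i)) ∧ κ (induces H (blowup G n) (λ i → ι (u i) (v i))))
    pairing u v u-incr κHv = Equivalence.from T-∧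
      ( increasing-incrB (ι-increasing u↑ v)
      , subst (T ∘ κ) (isoB-cong H (λ i≢j → sym (ι-adjacency u↑ v i≢j))) κHv)
      where
      u↑ : Increasing u
      u↑ = incrB-increasing {f = u} u-incr

  deficit : ℕ → ℕ
  deficit t = (n C t) ∸ (q C t) * k ^ t

  induced-vs-sampled : ∀ {t} (H : SimpleGraph t) →
    (inducedCount H (blowup G n) * k ^ t ≤ sampleCount H G * (n C t) + deficit t * k ^ t) ×
    (sampleCount H G * (n C t) ≤ inducedCount H (blowup G n) * k ^ t + deficit t * k ^ t)
  induced-vs-sampled {t} H =
    complementary-bounds-close {X = inducedCount H (blowup G n)} {s = sampleCount H G} {c = q C t}
      (trans (sym (count-split incrB (induces H (blowup G n)) (tuples t n))) (count-increasing t n))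
      (trans (sym (count-split (λ _ → true) (samples H G) (tuples t k))) (count-tuples-true t k))
      (count-blowup H id) (count-blowup H not)

  module _ {t} (H : List (SimpleGraph t)) where

    inducedTotal sampledTotal : ℕ
    inducedTotal = sum (map (λ H₁ → inducedCount H₁ (blowup G n)) H)
    sampledTotal = sum (map (λ H₁ → sampleCount H₁ G) H)

    totals-close :
      (inducedTotal * k ^ t ≤ sampledTotal * (n C t) + length H * (deficit t * k ^ t)) ×
      (sampledTotal * (n C t) ≤ inducedTotal * k ^ t + length H * (deficit t * k ^ t))
    totals-close =
        subst₂ (λ x y → x ≤ y + slack) (sum-map-*ʳ X (k ^ t) H) (sum-map-*ʳ S (n C t) H)
          (sum-map-≤ _ _ _ (proj₁ ∘ induced-vs-sampled) H)
      , subst₂ (λ x y → x ≤ y + slack) (sum-map-*ʳ S (n C t) H) (sum-map-*ʳ X (k ^ t) H)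
          (sum-map-≤ _ _ _ (proj₂ ∘ induced-vs-sampled) H)
      where
      slack : ℕ
      slack = length H * (deficit t * k ^ t)
      X S : SimpleGraph t → ℕ
      X H₁ = inducedCount H₁ (blowup G n)
      S H₁ = sampleCount H₁ G

-- Rational densities

frac-toℚᵘ : ∀ a d → ℚ.toℚᵘ (frac a (suc d)) ℚᵘ.≃ ℚᵘ.mkℚᵘ (ℤ.+ a) d
frac-toℚᵘ a d = ℚ.toℚᵘ-fromℚᵘ (ℚᵘ.mkℚᵘ (ℤ.+ a) d)

frac-+ : ∀ x y d .{{_ : NonZero d}} → frac x d ℚ.+ frac y d ≡ frac (x + y) d
frac-+ x y (suc d) = ℚ.toℚᵘ-injective toℚᵘ-equal
  where
  D : ℕ
  D = suc d
  cross : (ℤ.+ x ℤ.* ℤ.+ D ℤ.+ ℤ.+ y ℤ.* ℤ.+ D) ℤ.* ℤ.+ D ≡ ℤ.+ (x + y) ℤ.* ℤ.+ (D * D)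
  cross = begin
    (ℤ.+ x ℤ.* ℤ.+ D ℤ.+ ℤ.+ y ℤ.* ℤ.+ D) ℤ.* ℤ.+ D
      ≡⟨ cong (ℤ._* ℤ.+ D) (trans (ℤ.pos-+ (x * D) (y * D)) (cong₂ ℤ._+_ (ℤ.pos-* x D) (ℤ.pos-* y D))) ⟨
    ℤ.+ (x * D + y * D) ℤ.* ℤ.+ D
      ≡⟨ ℤ.pos-* (x * D + y * D) D ⟨
    ℤ.+ ((x * D + y * D) * D)
      ≡⟨ cong ℤ.+_ (solve 3 (λ x y D → (x :* D :+ y :* D) :* D := (x :+ y) :* (D :* D)) refl x y D) ⟩
    ℤ.+ ((x + y) * (D * D))
      ≡⟨ ℤ.pos-* (x + y) (D * D) ⟩
    ℤ.+ (x + y) ℤ.* ℤ.+ (D * D) ∎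
    where open ≡-Reasoning
  toℚᵘ-equal : ℚ.toℚᵘ (frac x D ℚ.+ frac y D) ℚᵘ.≃ ℚ.toℚᵘ (frac (x + y) D)
  toℚᵘ-equal = begin
    ℚ.toℚᵘ (frac x D ℚ.+ frac y D)                  ≈⟨ ℚ.toℚᵘ-homo-+ (frac x D) (frac y D) ⟩
    ℚ.toℚᵘ (frac x D) ℚᵘ.+ ℚ.toℚᵘ (frac y D)        ≈⟨ ℚᵘ.+-cong (frac-toℚᵘ x d) (frac-toℚᵘ y d) ⟩
    ℚᵘ.mkℚᵘ (ℤ.+ x) d ℚᵘ.+ ℚᵘ.mkℚᵘ (ℤ.+ y) d        ≈⟨ ℚᵘ.*≡* cross ⟩
    ℚᵘ.mkℚᵘ (ℤ.+ (x + y)) d                         ≈⟨ frac-toℚᵘ (x + y) d ⟨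
    ℚ.toℚᵘ (frac (x + y) D)                         ∎
    where open ℚᵘ.≃-Reasoning

frac-≤-frac+1/suc : ∀ A S e a b .{{_ : NonZero a}} .{{_ : NonZero b}} →
  A * b * suc e ≤ S * a * suc e + a * b → frac A a ℚ.≤ frac S b ℚ.+ frac 1 (suc e)
frac-≤-frac+1/suc A S e (suc a) (suc b) h = ℚ.toℚᵘ-cancel-≤ (begin
  ℚ.toℚᵘ (frac A (suc a))                                    ≃⟨ frac-toℚᵘ A a ⟩
  ℚᵘ.mkℚᵘ (ℤ.+ A) a                                          ≤⟨ ℚᵘ.*≤* cross ⟩
  ℚᵘ.mkℚᵘ (ℤ.+ S) b ℚᵘ.+ ℚᵘ.mkℚᵘ (ℤ.+ 1) e
    ≃⟨ ℚᵘ.+-cong (frac-toℚᵘ S b) (frac-toℚᵘ 1 e) ⟨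
  ℚ.toℚᵘ (frac S (suc b)) ℚᵘ.+ ℚ.toℚᵘ (frac 1 (suc e))
    ≃⟨ ℚ.toℚᵘ-homo-+ (frac S (suc b)) (frac 1 (suc e)) ⟨
  ℚ.toℚᵘ (frac S (suc b) ℚ.+ frac 1 (suc e))                 ∎)
  where
  open ℚᵘ.≤-Reasoning
  a′ b′ e′ : ℕ
  a′ = suc a
  b′ = suc b
  e′ = suc e
  h′ : A * (b′ * e′) ≤ (S * e′ + 1 * b′) * a′
  h′ = subst₂ _≤_ (*-assoc A b′ e′)
         (solve 4 (λ S a b e → S :* a :* e :+ a :* b := (S :* e :+ con 1 :* b) :* a) refl S a′ b′ e′) h
  cross : ℤ.+ A ℤ.* ℤ.+ (b′ * e′) ℤ.≤ (ℤ.+ S ℤ.* ℤ.+ e′ ℤ.+ ℤ.+ 1 ℤ.* ℤ.+ b′) ℤ.* ℤ.+ a′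
  cross = subst₂ ℤ._≤_ (ℤ.pos-* A (b′ * e′))
            (trans (ℤ.pos-* (S * e′ + 1 * b′) a′)
              (cong (ℤ._* ℤ.+ a′) (trans (ℤ.pos-+ (S * e′) (1 * b′)) (cong₂ ℤ._+_ (ℤ.pos-* S e′) (ℤ.pos-* 1 b′)))))
            (ℤ.+≤+ h′)

sumℚ-frac : ∀ {A : Set} (f : A → ℕ) d .{{_ : NonZero d}} xs →
  sumℚ (map (λ x → frac (f x) d) xs) ≡ frac (sum (map f xs)) d
sumℚ-frac f (suc d) []       = ℚ.toℚᵘ-injective (ℚᵘ.≃-trans (ℚᵘ.*≡* refl) (ℚᵘ.≃-sym (frac-toℚᵘ 0 d)))
sumℚ-frac f d@(suc _) (x ∷ xs) = trans (cong (frac (f x) d ℚ.+_) (sumℚ-frac f d xs)) (frac-+ (f x) _ d)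

1/suc≤pos : ∀ {ε} → 0ℚ ℚ.< ε → ∃[ e ] frac 1 (suc e) ℚ.≤ ε
1/suc≤pos {mkℚ ℤ.+[1+ p ] d _} _ = d , ℚ.toℚᵘ-cancel-≤ (ℚᵘ.≤-respˡ-≃ (ℚᵘ.≃-sym (frac-toℚᵘ 1 d))
  (ℚᵘ.*≤* (subst₂ ℤ._≤_ (ℤ.pos-* 1 (suc d)) (ℤ.pos-* (suc p) (suc d))
    (ℤ.+≤+ (*-monoˡ-≤ (suc d) (s≤s (z≤n {p})))))))
1/suc≤pos {mkℚ (ℤ.+ 0) d _} (ℚ.*<* 0<0) = ⊥-elim (ℤ.<-irrefl refl 0<0)
1/suc≤pos {mkℚ ℤ.-[1+ p ] d _} (ℚ.*<* 0<neg) = ⊥-elim (ℤ.<-asym 0<neg ℤ.-<+)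

p≤q+r⇒p-r≤q : ∀ {p q r} → p ℚ.≤ q ℚ.+ r → p ℚ.- r ℚ.≤ q
p≤q+r⇒p-r≤q {p} {q} {r} p≤q+r = begin
  p ℚ.- r             ≤⟨ ℚ.+-monoˡ-≤ (ℚ.- r) p≤q+r ⟩
  q ℚ.+ r ℚ.- r       ≡⟨ ℚ.+-assoc q r (ℚ.- r) ⟩
  q ℚ.+ (r ℚ.- r)     ≡⟨ cong (q ℚ.+_) (ℚ.+-inverseʳ r) ⟩
  q ℚ.+ 0ℚ            ≡⟨ ℚ.+-identityʳ q ⟩
  q                   ∎
  where open ℚ.≤-Reasoning

blowup-approximates : ∀ {t k} .{{_ : NonZero k}} (H : List (SimpleGraph t)) (G : LoopGraph k) e n →
  length H * suc e * (t * (k * t)) + t ≤ n →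
  (P H (blowup G n) ℚ.≤ R H G ℚ.+ frac 1 (suc e)) × (R H G ℚ.≤ P H (blowup G n) ℚ.+ frac 1 (suc e))
blowup-approximates {t} {k} H G e n N≤n =
    subst₂ (λ p r → p ℚ.≤ r ℚ.+ frac 1 (suc e)) (sym P≡) (sym R≡)
      (frac-≤-frac+1/suc _ _ e D K (absorb-deficit (proj₁ (totals-close H))))
  , subst₂ (λ p r → r ℚ.≤ p ℚ.+ frac 1 (suc e)) (sym P≡) (sym R≡)
      (frac-≤-frac+1/suc _ _ e K D (subst (λ z → sampledTotal H * D * suc e ≤ inducedTotal H * K * suc e + z)
        (*-comm D K) (absorb-deficit (proj₂ (totals-close H)))))
  where
  open Blowup G n
  h D K τ β : ℕ
  h = length H
  D = n C t
  K = k ^ t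
  τ = t * (k * t)
  β = suc (n ∸ t)
  t≤n : t ≤ n
  t≤n = m+n≤o⇒n≤o _ N≤n
  instance
    D≢0 : NonZero D
    D≢0 = >-nonZero (k≤n⇒nCk>0 t≤n)
    K≢0 : NonZero K
    K≢0 = m^n≢0 k t
  P≡ : P H (blowup G n) ≡ frac (inducedTotal H) D
  P≡ = sumℚ-frac (λ H₁ → inducedCount H₁ (blowup G n)) D H
  R≡ : R H G ≡ frac (sampledTotal H) K
  R≡ = sumℚ-frac (λ H₁ → sampleCount H₁ G) K H
  deficit-small : h * deficit t * suc e ≤ D
  deficit-small = *-cancelʳ-≤ (h * deficit t * suc e) D β (begin
    h * deficit t * suc e * β   ≡⟨ solve 4 (λ h E e β → h :* E :* e :* β := h :* e :* (E :* β))
                                           refl h (deficit t) (suc e) β ⟩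
    h * suc e * (deficit t * β) ≤⟨ *-monoʳ-≤ (h * suc e) (binomial-blocks-deficit k n t t≤n) ⟩
    h * suc e * (τ * D)         ≡⟨ *-assoc (h * suc e) τ D ⟨
    h * suc e * τ * D           ≤⟨ *-monoˡ-≤ D (≤-trans (m+n≤o⇒m≤o∸n (h * suc e * τ) N≤n) (n≤1+n (n ∸ t))) ⟩
    β * D                       ≡⟨ *-comm β D ⟩
    D * β                       ∎)
    where open ≤-Reasoning
  absorb-deficit : ∀ {x y} → x ≤ y + h * (deficit t * K) → x * suc e ≤ y * suc e + D * K
  absorb-deficit {x} {y} x≤ = begin
    x * suc e                             ≤⟨ *-monoˡ-≤ (suc e) x≤ ⟩
    (y + h * (deficit t * K)) * suc e     ≡⟨ solve 5 (λ y h E K e → (y :+ h :* (E :* K)) :* e := y :* e :+ h :* E :* e :* K)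
                                                     refl y h (deficit t) K (suc e) ⟩
    y * suc e + h * deficit t * suc e * K ≤⟨ +-monoʳ-≤ (y * suc e) (*-monoˡ-≤ K deficit-small) ⟩
    y * suc e + D * K                     ∎
    where open ≤-Reasoning

lemma1 : (t : ℕ) (H : List (SimpleGraph t)) (m : ℕ) (G : LoopGraph (suc m)) →
    ((ε : ℚ) → 0ℚ ℚ.< ε → ∃[ N ] ((n : ℕ) → N ≤ n →
        Σ (SimpleGraph n) (λ G′ → P H G′ ℚ.≤ R H G ℚ.+ ε)))
    ×
    ((ε : ℚ) → 0ℚ ℚ.< ε → ∃[ N ] ((n : ℕ) → N ≤ n →
        Σ (SimpleGraph n) (λ G′ → R H G ℚ.- ε ℚ.≤ P H G′)))
lemma1 t H m G =
    (λ ε ε>0 → let e , 1/e≤ε = 1/suc≤pos ε>0 in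
       threshold e , λ n N≤n → blowup G n ,
         ℚ.≤-trans (proj₁ (blowup-approximates H G e n N≤n)) (ℚ.+-monoʳ-≤ (R H G) 1/e≤ε))
  , (λ ε ε>0 → let e , 1/e≤ε = 1/suc≤pos ε>0 in
       threshold e , λ n N≤n → blowup G n ,
         p≤q+r⇒p-r≤q (ℚ.≤-trans (proj₂ (blowup-approximates H G e n N≤n))
                                (ℚ.+-monoʳ-≤ (P H (blowup G n)) 1/e≤ε)))
  where
  threshold : ℕ → ℕ
  threshold e = length H * suc e * (t * (suc m * t)) + t
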